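{- Let $\mathbf{PSet}$ be the category of sets equipped with a predicate, and consider the diagram consisting of $\mathrm{Lift} : \mathbf{PSet} \to \mathbf{PSet}^{\downarrow}$, $\mathrm{cod} : \mathbf{PSet}^{\downarrow} \to \mathbf{PSet}$ on top, $T : \mathbf{Set} \to \mathbf{Set}^{\downarrow}$, $\mathrm{cod} : \mathbf{Set}^{\downarrow} \to \mathbf{Set}$ on the bottom, and vertical functors $p : \mathbf{PSet} \to \mathbf{Set}$, $p^{\downarrow} : \mathbf{PSet}^{\downarrow} \to \mathbf{Set}^{\downarrow}$, $p : \mathbf{PSet} \to \mathbf{Set}$, where $$T S = (\pi_1 : S \times S \to S), \qquad \mathrm{Lift}(S, \varphi) = \big(\pi_1 : (S \times S, \varphi \times \varphi) \to (S, \varphi)\big).$$ Then this is a cartesian monoidal fibration of tangencies from $(\mathrm{cod}: \mathbf{PSet}^{\downarrow}\to\mathbf{PSet}, \mathrm{Lift})$ to $(\mathrm{cod} : \mathbf{Set}^{\downarrow} \to \mathbf{Set}, T)$.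
   Context: $\mathbf{PSet} = \int^{X \in \mathbf{Set}} \mathbf{Set}(X, \mathsf{bool})$ is the category whose objects are pairs $(X, \varphi)$ of a set $X$ and a predicate $\varphi : X \to \mathsf{bool}$, and whose morphisms $(X,\varphi) \to (Y,\psi)$ are functions $f : X \to Y$ with $\varphi(x) \Rightarrow \psi(f(x))$ for all $x$; $p : \mathbf{PSet} \to \mathbf{Set}$ forgets the predicate. For a category $\mathcal{C}$, $\mathcal{C}^{\downarrow}$ is its arrow category and $\mathrm{cod}$ the codomain functor; $p^{\downarrow}$ applies $p$ to arrows. $(\varphi \times \varphi)(s, s') = \varphi(s) \wedge \varphi(s')$. A tangency is a cloven Grothendieck fibration $\pi : \mathcal{E} \to \mathcal{B}$ with a section $T$. A fibration of tangencies from $(\mathcal{P}\pi : \mathcal{PE} \to \mathcal{PB}, \mathrm{Lift})$ to $(\pi : \mathcal{E} \to \mathcal{B}, T)$ consists of functors $p_{\mathcal{B}} : \mathcal{PB} \to \mathcal{B}$, $p_{\mathcal{E}} : \mathcal{PE} \to \mathcal{E}$ with $\pi p_{\mathcal{E}} = p_{\mathcal{B}} \mathcal{P}\pi$ and $p_{\mathcal{E}} \mathrm{Lift} = T p_{\mathcal{B}}$, such that $p_{\mathcal{B}}, p_{\mathcal{E}}$ are Grothendieck fibrations, $p_{\mathcal{E}}$ sends chosen $\mathcal{P}\pi$-cartesian morphisms to chosen $\pi$-cartesian morphisms, and $\mathrm{Lift}$ sends $p_{\mathcal{B}}$-cartesian morphisms to $p_{\mathcal{E}}$-cartesian morphisms;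 it is cartesian monoidal when all categories carry cartesian monoidal structures, $p_{\mathcal{B}}, p_{\mathcal{E}}$ are strict monoidal fibrations, and the diagram commutes as a diagram of symmetric monoidal categories and lax symmetric monoidal functors. -}

module Defs where

-- NOTE: this development uses Agda's default (with-K) setting, so that the
-- category of Agda types Set₀ with pointwise-equal functions behaves as the
-- category of sets (all types satisfy UIP).

open import Data.Bool using (Bool; true; false; _∧_)
open import Data.Product using (Σ; _×_; _,_; proj₁; proj₂; Σ-syntax)
open import Relation.Binary.PropositionalEquality using (_≡_; refl; sym; trans; cong)

record Cat : Set₂ where
  infixr 9 _∘_
  infix 4 _≈_
  field
    Obj : Set₁
    Hom : Obj → Obj → Set
    _≈_ : ∀ {A B} → Hom A B → Hom A B → Set
    id : ∀ {A} → Hom A A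
    _∘_ : ∀ {A B C} → Hom B C → Hom A B → Hom A C
    ≈-refl : ∀ {A B} {f : Hom A B} → f ≈ f
    ≈-sym : ∀ {A B} {f g : Hom A B} → f ≈ g → g ≈ f
    ≈-trans : ∀ {A B} {f g h : Hom A B} → f ≈ g → g ≈ h → f ≈ h
    ∘-resp-≈ : ∀ {A B C} {f f' : Hom B C} {g g' : Hom A B} →
               f ≈ f' → g ≈ g' → f ∘ g ≈ f' ∘ g'
    identityˡ : ∀ {A B} {f : Hom A B} → id ∘ f ≈ f
    identityʳ : ∀ {A B} {f : Hom A B} → f ∘ id ≈ f
    assoc : ∀ {A B C D} {f : Hom C D} {g : Hom B C} {h : Hom A B} →
            (f ∘ g) ∘ h ≈ f ∘ (g ∘ h)

  idTo : ∀ {A B} → A ≡ B → Hom A B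
  idTo refl = id

module _ (C D : Cat) where
  private
    module C = Cat C
    module D = Cat D

  record Functor : Set₁ where
    field
      F₀ : C.Obj → D.Obj
      F₁ : ∀ {A B} → C.Hom A B → D.Hom (F₀ A) (F₀ B)
      F-resp-≈ : ∀ {A B} {f g : C.Hom A B} → f C.≈ g → F₁ f D.≈ F₁ g
      F-id : ∀ {A} → F₁ (C.id {A}) D.≈ D.id
      F-∘ : ∀ {A B E} (f : C.Hom B E) (g : C.Hom A B) →
            F₁ (f C.∘ g) D.≈ F₁ f D.∘ F₁ g

module _ {C D : Cat} where
  private
    module C = Cat C
    module D = Cat D

  record FunctorEq (F G : Functor C D) : Set₁ where
    private
      module F = Functor F
      module G = Functor G
    field
      eq₀ : ∀ X → F.F₀ X ≡ G.F₀ X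
      eq₁ : ∀ {A B} (f : C.Hom A B) →
            F.F₁ f D.≈ (D.idTo (sym (eq₀ B)) D.∘ (G.F₁ f D.∘ D.idTo (eq₀ A)))

IdF : (C : Cat) → Functor C C
IdF C = record
  { F₀ = λ X → X ; F₁ = λ f → f ; F-resp-≈ = λ p → p
  ; F-id = ≈-refl ; F-∘ = λ f g → ≈-refl }
  where open Cat C

infixr 9 _∘F_
_∘F_ : {C D E : Cat} → Functor D E → Functor C D → Functor C E
_∘F_ {C} {D} {E} G F = record
  { F₀ = λ X → G.F₀ (F.F₀ X)
  ; F₁ = λ f → G.F₁ (F.F₁ f)
  ; F-resp-≈ = λ p → G.F-resp-≈ (F.F-resp-≈ p)
  ; F-id = E.≈-trans (G.F-resp-≈ F.F-id) G.F-id
  ; F-∘ = λ f g → E.≈-trans (G.F-resp-≈ (F.F-∘ f g)) (G.F-∘ (F.F₁ f) (F.F₁ g))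
  }
  where
    module E = Cat E
    module F = Functor F
    module G = Functor G

module _ {E B : Cat} (P : Functor E B) where
  private
    module E = Cat E
    module B = Cat B
  open Functor P

  IsCartesian : ∀ {e' e} → E.Hom e' e → Set₁
  IsCartesian {e'} {e} f =
    ∀ {e''} (g : E.Hom e'' e) (h : B.Hom (F₀ e'') (F₀ e')) →
    (F₁ f B.∘ h) B.≈ F₁ g →
    Σ[ k ∈ E.Hom e'' e' ]
      (((f E.∘ k) E.≈ g × F₁ k B.≈ h) ×
       (∀ (k' : E.Hom e'' e') → (f E.∘ k') E.≈ g → F₁ k' B.≈ h → k' E.≈ k))

  record CartLift {b : B.Obj} (e : E.Obj) (u : B.Hom b (F₀ e)) : Set₁ where
    field
      dom : E.Obj
      dom-eq : F₀ dom ≡ b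
      arr : E.Hom dom e
      arr-over : F₁ arr B.≈ (u B.∘ B.idTo dom-eq)
      arr-cart : IsCartesian arr

  Cleavage : Set₁
  Cleavage = ∀ {b : B.Obj} (e : E.Obj) (u : B.Hom b (F₀ e)) → CartLift e u

  record RawLift {b : B.Obj} (e : E.Obj) (u : B.Hom b (F₀ e)) : Set₁ where
    field
      dom : E.Obj
      dom-eq : F₀ dom ≡ b
      arr : E.Hom dom e

  RawCleavage : Set₁
  RawCleavage = ∀ {b : B.Obj} (e : E.Obj) (u : B.Hom b (F₀ e)) → RawLift e u

  IsCleavage : RawCleavage → Set₁
  IsCleavage c = ∀ {b : B.Obj} (e : E.Obj) (u : B.Hom b (F₀ e)) →
    (F₁ (RawLift.arr (c e u)) B.≈ (u B.∘ B.idTo (RawLift.dom-eq (c e u))))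
    × IsCartesian (RawLift.arr (c e u))

record Tangency (E B : Cat) : Set₁ where
  field
    π : Functor E B
    lift : RawCleavage π
    T : Functor B E

record IsTangency {E B : Cat} (t : Tangency E B) : Set₁ where
  open Tangency t
  field
    cloven : IsCleavage π lift
    section : FunctorEq (π ∘F T) (IdF B)

record IsFibrationOfTangencies {PE PB E B : Cat}
    (t₁ : Tangency PE PB) (t₂ : Tangency E B)
    (pB : Functor PB B) (pE : Functor PE E) : Set₁ where
  private
    module PB = Cat PB
    module E = Cat E
    module B = Cat B
    module t₁ = Tangency t₁
    module t₂ = Tangency t₂
    module Pπ = Functor t₁.π
    module π = Functor t₂.π
    module pB = Functor pB
    module pE = Functor pE
    module Lift = Functor t₁.T
  field
    source-tangency : IsTangency t₁
    target-tangency : IsTangency t₂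
    square-π : FunctorEq (t₂.π ∘F pE) (pB ∘F t₁.π)
    square-T : FunctorEq (pE ∘F t₁.T) (t₂.T ∘F pB)
    pB-fibration : Cleavage pB
    pE-fibration : Cleavage pE
    chosen-to-chosen :
      ∀ {b : PB.Obj} (e : _) (u : PB.Hom b (Pπ.F₀ e)) →
      let L = t₁.lift e u
          L' = t₂.lift (pE.F₀ e)
                 (B.idTo (sym (FunctorEq.eq₀ square-π e)) B.∘ pB.F₁ u)
      in Σ[ q ∈ pE.F₀ (RawLift.dom L) ≡ RawLift.dom L' ]
           (pE.F₁ (RawLift.arr L) E.≈ (RawLift.arr L' E.∘ E.idTo q))
    Lift-cartesian : ∀ {X Y} (f : PB.Hom X Y) →
      IsCartesian pB f → IsCartesian pE (Lift.F₁ f)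

record Cartesian (C : Cat) : Set₁ where
  open Cat C
  infixr 10 _⊗₀_ _⊗₁_
  field
    𝟙 : Obj
    ! : ∀ {A} → Hom A 𝟙
    !-unique : ∀ {A} (f : Hom A 𝟙) → f ≈ !
    _⊗₀_ : Obj → Obj → Obj
    π₁ : ∀ {A B} → Hom (A ⊗₀ B) A
    π₂ : ∀ {A B} → Hom (A ⊗₀ B) B
    ⟨_,_⟩ : ∀ {X A B} → Hom X A → Hom X B → Hom X (A ⊗₀ B)
    β₁ : ∀ {X A B} {f : Hom X A} {g : Hom X B} → π₁ ∘ ⟨ f , g ⟩ ≈ f
    β₂ : ∀ {X A B} {f : Hom X A} {g : Hom X B} → π₂ ∘ ⟨ f , g ⟩ ≈ g
    ⟨⟩-unique : ∀ {X A B} {f : Hom X A} {g : Hom X B} {h : Hom X (A ⊗₀ B)} →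
                π₁ ∘ h ≈ f → π₂ ∘ h ≈ g → h ≈ ⟨ f , g ⟩

  _⊗₁_ : ∀ {A A' B B'} → Hom A A' → Hom B B' → Hom (A ⊗₀ B) (A' ⊗₀ B')
  f ⊗₁ g = ⟨ f ∘ π₁ , g ∘ π₂ ⟩

  α⇒ : ∀ A B C → Hom ((A ⊗₀ B) ⊗₀ C) (A ⊗₀ (B ⊗₀ C))
  α⇒ A B C = ⟨ π₁ ∘ π₁ , ⟨ π₂ ∘ π₁ , π₂ ⟩ ⟩

  λ⇒ : ∀ A → Hom (𝟙 ⊗₀ A) A
  λ⇒ A = π₂

  ρ⇒ : ∀ A → Hom (A ⊗₀ 𝟙) A
  ρ⇒ A = π₁

  σ⇒ : ∀ A B → Hom (A ⊗₀ B) (B ⊗₀ A)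
  σ⇒ A B = ⟨ π₂ , π₁ ⟩

module _ {C D : Cat} (CC : Cartesian C) (CD : Cartesian D) where
  private
    module C = Cat C
    module D = Cat D
    module CC = Cartesian CC
    module CD = Cartesian CD

  record MonStr (F : Functor C D) : Set₁ where
    open Functor F
    field
      ε : D.Hom CD.𝟙 (F₀ CC.𝟙)
      μ : ∀ A B → D.Hom (F₀ A CD.⊗₀ F₀ B) (F₀ (A CC.⊗₀ B))

  record IsLaxSymMonoidal {F : Functor C D} (m : MonStr F) : Set₁ where
    open Functor F
    open MonStr m
    field
      μ-natural : ∀ {A A' B B'} (f : C.Hom A A') (g : C.Hom B B') →
        (F₁ (f CC.⊗₁ g) D.∘ μ A B) D.≈ (μ A' B' D.∘ (F₁ f CD.⊗₁ F₁ g))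
      μ-assoc : ∀ A B E →
        (F₁ (CC.α⇒ A B E) D.∘ (μ (A CC.⊗₀ B) E D.∘ (μ A B CD.⊗₁ D.id)))
        D.≈ (μ A (B CC.⊗₀ E) D.∘ ((D.id CD.⊗₁ μ B E) D.∘ CD.α⇒ (F₀ A) (F₀ B) (F₀ E)))
      μ-unitˡ : ∀ A →
        (F₁ (CC.λ⇒ A) D.∘ (μ CC.𝟙 A D.∘ (ε CD.⊗₁ D.id))) D.≈ CD.λ⇒ (F₀ A)
      μ-unitʳ : ∀ A →
        (F₁ (CC.ρ⇒ A) D.∘ (μ A CC.𝟙 D.∘ (D.id CD.⊗₁ ε))) D.≈ CD.ρ⇒ (F₀ A)
      μ-symm : ∀ A B →
        (F₁ (CC.σ⇒ A B) D.∘ μ A B) D.≈ (μ B A D.∘ CD.σ⇒ (F₀ A) (F₀ B))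

  record LaxSymMonoidal (F : Functor C D) : Set₁ where
    field
      str : MonStr F
      laws : IsLaxSymMonoidal str

  MonEq : {F G : Functor C D} → FunctorEq F G → MonStr F → MonStr G → Set₁
  MonEq {F} {G} e mF mG =
    (MonStr.ε mF D.≈ (D.idTo (sym (eq₀ CC.𝟙)) D.∘ MonStr.ε mG))
    × (∀ A B → MonStr.μ mF A B D.≈
         (D.idTo (sym (eq₀ (A CC.⊗₀ B))) D.∘
           (MonStr.μ mG A B D.∘ (D.idTo (eq₀ A) CD.⊗₁ D.idTo (eq₀ B)))))
    where open FunctorEq e

  record IsStrictMonoidalFibration (P : Functor C D) (m : LaxSymMonoidal P) : Set₁ where
    open Functor P
    open MonStr (LaxSymMonoidal.str m)
    field
      unit-eq : F₀ CC.𝟙 ≡ CD.𝟙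
      tensor-eq : ∀ A B → F₀ (A CC.⊗₀ B) ≡ F₀ A CD.⊗₀ F₀ B
      ε-strict : ε D.≈ D.idTo (sym unit-eq)
      μ-strict : ∀ A B → μ A B D.≈ D.idTo (sym (tensor-eq A B))
      ⊗-cartesian : ∀ {A A' B B'} (f : C.Hom A A') (g : C.Hom B B') →
        IsCartesian P f → IsCartesian P g → IsCartesian P (f CC.⊗₁ g)

_⊙_ : {C D E : Cat} {CC : Cartesian C} {CD : Cartesian D} {CE : Cartesian E}
      {G : Functor D E} {F : Functor C D} →
      MonStr CD CE G → MonStr CC CD F → MonStr CC CE (G ∘F F)
_⊙_ {E = E} {G = G} {F = F} mG mF = record
  { ε = G.F₁ (MonStr.ε mF) E.∘ MonStr.ε mG
  ; μ = λ A B → G.F₁ (MonStr.μ mF A B) E.∘ MonStr.μ mG (F.F₀ A) (F.F₀ B)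
  }
  where
    module E = Cat E
    module G = Functor G
    module F = Functor F

record IsCartesianMonoidalFibrationOfTangencies {PE PB E B : Cat}
    (t₁ : Tangency PE PB) (t₂ : Tangency E B)
    (pB : Functor PB B) (pE : Functor PE E) : Set₁ where
  private
    module t₁ = Tangency t₁
    module t₂ = Tangency t₂
  field
    fibration : IsFibrationOfTangencies t₁ t₂ pB pE
    cart-PE : Cartesian PE
    cart-PB : Cartesian PB
    cart-E : Cartesian E
    cart-B : Cartesian B
    mon-Pπ : LaxSymMonoidal cart-PE cart-PB t₁.π
    mon-Lift : LaxSymMonoidal cart-PB cart-PE t₁.T
    mon-π : LaxSymMonoidal cart-E cart-B t₂.π
    mon-T : LaxSymMonoidal cart-B cart-E t₂.T
    mon-pB : LaxSymMonoidal cart-PB cart-B pB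
    mon-pE : LaxSymMonoidal cart-PE cart-E pE
    pB-strict : IsStrictMonoidalFibration cart-PB cart-B pB mon-pB
    pE-strict : IsStrictMonoidalFibration cart-PE cart-E pE mon-pE
    square-π-monoidal :
      MonEq cart-PE cart-B (IsFibrationOfTangencies.square-π fibration)
        (LaxSymMonoidal.str mon-π ⊙ LaxSymMonoidal.str mon-pE)
        (LaxSymMonoidal.str mon-pB ⊙ LaxSymMonoidal.str mon-Pπ)
    square-T-monoidal :
      MonEq cart-PB cart-E (IsFibrationOfTangencies.square-T fibration)
        (LaxSymMonoidal.str mon-pE ⊙ LaxSymMonoidal.str mon-Lift)
        (LaxSymMonoidal.str mon-T ⊙ LaxSymMonoidal.str mon-pB)

module Arrow (C : Cat) where
  open Cat C

  record ArrObj : Set₁ where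
    constructor arrObj
    field
      src : Obj
      tgt : Obj
      arr : Hom src tgt
  open ArrObj

  record Sq (X Y : ArrObj) : Set where
    constructor sq
    field
      top : Hom (src X) (src Y)
      bot : Hom (tgt X) (tgt Y)
      comm : (arr Y ∘ top) ≈ (bot ∘ arr X)
  open Sq

  ArrCat : Cat
  ArrCat = record
    { Obj = ArrObj
    ; Hom = Sq
    ; _≈_ = λ s t → (top s ≈ top t) × (bot s ≈ bot t)
    ; id = λ {X} → sq id id (≈-trans identityʳ (≈-sym identityˡ))
    ; _∘_ = comp
    ; ≈-refl = ≈-refl , ≈-refl
    ; ≈-sym = λ (p , q) → ≈-sym p , ≈-sym q
    ; ≈-trans = λ (p , q) (p' , q') → ≈-trans p p' , ≈-trans q q'
    ; ∘-resp-≈ = λ (p , q) (p' , q') → ∘-resp-≈ p p' , ∘-resp-≈ q q'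
    ; identityˡ = identityˡ , identityˡ
    ; identityʳ = identityʳ , identityʳ
    ; assoc = assoc , assoc
    }
    where
      comp : ∀ {X Y Z} → Sq Y Z → Sq X Y → Sq X Z
      comp {X} {Y} {Z} t s = sq (top t ∘ top s) (bot t ∘ bot s)
        (≈-trans (≈-sym assoc)
        (≈-trans (∘-resp-≈ (comm t) ≈-refl)
        (≈-trans assoc
        (≈-trans (∘-resp-≈ ≈-refl (comm s))
        (≈-sym assoc)))))

  cod : Functor ArrCat C
  cod = record
    { F₀ = tgt ; F₁ = bot ; F-resp-≈ = proj₂
    ; F-id = ≈-refl ; F-∘ = λ f g → ≈-refl }

infix 20 _↓
_↓ : Cat → Cat
C ↓ = Arrow.ArrCat C

cod : (C : Cat) → Functor (C ↓) C
cod C = Arrow.cod C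

_↓F : {C D : Cat} → Functor C D → Functor (C ↓) (D ↓)
_↓F {C} {D} F = record
  { F₀ = λ X → D↓.arrObj (F₀ (C↓.ArrObj.src X)) (F₀ (C↓.ArrObj.tgt X)) (F₁ (C↓.ArrObj.arr X))
  ; F₁ = λ {X} {Y} s → D↓.sq (F₁ (C↓.Sq.top s)) (F₁ (C↓.Sq.bot s))
           (D.≈-trans (D.≈-sym (F-∘ (C↓.ArrObj.arr Y) (C↓.Sq.top s)))
           (D.≈-trans (F-resp-≈ (C↓.Sq.comm s))
           (F-∘ (C↓.Sq.bot s) (C↓.ArrObj.arr X))))
  ; F-resp-≈ = λ (p , q) → F-resp-≈ p , F-resp-≈ q
  ; F-id = F-id , F-id
  ; F-∘ = λ f g → F-∘ (C↓.Sq.top f) (C↓.Sq.top g) , F-∘ (C↓.Sq.bot f) (C↓.Sq.bot g)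
  }
  where
    module C↓ = Arrow C
    module D↓ = Arrow D
    module D = Cat D
    open Functor F

SetC : Cat
SetC = record
  { Obj = Set
  ; Hom = λ A B → A → B
  ; _≈_ = λ f g → ∀ x → f x ≡ g x
  ; id = λ x → x
  ; _∘_ = λ g f x → g (f x)
  ; ≈-refl = λ x → refl
  ; ≈-sym = λ p x → sym (p x)
  ; ≈-trans = λ p q x → trans (p x) (q x)
  ; ∘-resp-≈ = λ {f = f} {f'} {g} {g'} p q x → trans (cong f (q x)) (p (g' x))
  ; identityˡ = λ x → refl
  ; identityʳ = λ x → refl
  ; assoc = λ x → refl
  }

PSet : Cat
PSet = record
  { Obj = Σ Set (λ X → X → Bool)
  ; Hom = λ (X , φ) (Y , ψ) → Σ (X → Y) (λ f → ∀ x → φ x ≡ true → ψ (f x) ≡ true)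
  ; _≈_ = λ f g → ∀ x → proj₁ f x ≡ proj₁ g x
  ; id = (λ x → x) , (λ x p → p)
  ; _∘_ = λ (g , hg) (f , hf) → (λ x → g (f x)) , (λ x p → hg (f x) (hf x p))
  ; ≈-refl = λ x → refl
  ; ≈-sym = λ p x → sym (p x)
  ; ≈-trans = λ p q x → trans (p x) (q x)
  ; ∘-resp-≈ = λ {f = f} {f'} {g} {g'} p q x →
      trans (cong (proj₁ f) (q x)) (p (proj₁ g' x))
  ; identityˡ = λ x → refl
  ; identityʳ = λ x → refl
  ; assoc = λ x → refl
  }

p : Functor PSet SetC
p = record
  { F₀ = proj₁ ; F₁ = proj₁ ; F-resp-≈ = λ q → q
  ; F-id = λ x → refl ; F-∘ = λ f g x → refl }

∧-true₁ : ∀ a b → a ∧ b ≡ true → a ≡ true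
∧-true₁ true b _ = refl
∧-true₁ false b ()

∧-true₂ : ∀ a b → a ∧ b ≡ true → b ≡ true
∧-true₂ true b q = q
∧-true₂ false b ()

∧-intro : ∀ {a b} → a ≡ true → b ≡ true → a ∧ b ≡ true
∧-intro refl q = q

T : Functor SetC (SetC ↓)
T = record
  { F₀ = λ S → arrObj (S × S) S proj₁
  ; F₁ = λ f → sq (λ (s , s') → f s , f s') f (λ x → refl)
  ; F-resp-≈ = λ q → (λ (s , s') → cong₂' (q s) (q s')) , q
  ; F-id = (λ x → refl) , (λ x → refl)
  ; F-∘ = λ f g → (λ x → refl) , (λ x → refl)
  }
  where
    open Arrow SetC
    cong₂' : ∀ {A : Set} {a a' b b' : A} → a ≡ a' → b ≡ b' → (a , b) ≡ (a' , b')
    cong₂' refl refl = refl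

_⊠_ : {X Y : Set} → (X → Bool) → (Y → Bool) → X × Y → Bool
(φ ⊠ ψ) (x , y) = φ x ∧ ψ y

Lift : Functor PSet (PSet ↓)
Lift = record
  { F₀ = λ (S , φ) → arrObj ((S × S) , (φ ⊠ φ)) (S , φ)
                       (proj₁ , λ (s , s') q → ∧-true₁ (φ s) (φ s') q)
  ; F₁ = λ {(S , φ)} {(S' , ψ)} (f , hf) →
           sq ((λ (s , s') → f s , f s') ,
               (λ (s , s') q → ∧-intro (hf s (∧-true₁ (φ s) (φ s') q))
                                       (hf s' (∧-true₂ (φ s) (φ s') q))))
              (f , hf) (λ x → refl)
  ; F-resp-≈ = λ q → (λ (s , s') → cong₂' (q s) (q s')) , q
  ; F-id = (λ x → refl) , (λ x → refl)
  ; F-∘ = λ f g → (λ x → refl) , (λ x → refl)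
  }
  where
    open Arrow PSet
    cong₂' : ∀ {A : Set} {a a' b b' : A} → a ≡ a' → b ≡ b' → (a , b) ≡ (a' , b')
    cong₂' refl refl = refl

pullbackSet : RawCleavage (cod SetC)
pullbackSet {B'} (Arrow.arrObj A B f) u = record
  { dom = Arrow.arrObj (Σ (A × B') (λ (a , b') → f a ≡ u b')) B' (λ x → proj₂ (proj₁ x))
  ; dom-eq = refl
  ; arr = Arrow.sq (λ x → proj₁ (proj₁ x)) u (λ x → proj₂ x)
  }

pullbackPSet : RawCleavage (cod PSet)
pullbackPSet {B' , β'} (Arrow.arrObj (A , α) (B , β) (f , hf)) (u , hu) = record
  { dom = Arrow.arrObj
            (Σ (A × B') (λ (a , b') → f a ≡ u b') ,
             (λ x → α (proj₁ (proj₁ x)) ∧ β' (proj₂ (proj₁ x))))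
            (B' , β')
            ((λ x → proj₂ (proj₁ x)) ,
             (λ x q → ∧-true₂ (α (proj₁ (proj₁ x))) (β' (proj₂ (proj₁ x))) q))
  ; dom-eq = refl
  ; arr = Arrow.sq
            ((λ x → proj₁ (proj₁ x)) ,
             (λ x q → ∧-true₁ (α (proj₁ (proj₁ x))) (β' (proj₂ (proj₁ x))) q))
            (u , hu) (λ x → proj₂ x)
  }

SetTangency : Tangency (SetC ↓) SetC
SetTangency = record { π = cod SetC ; lift = pullbackSet ; T = T }

PSetTangency : Tangency (PSet ↓) PSet
PSetTangency = record { π = cod PSet ; lift = pullbackPSet ; T = Lift }

{-# OPTIONS --safe #-}
module Submission where

open import Defs
open import Algebra.Bundles using (CommutativeMonoid)
open import Axiom.UniquenessOfIdentityProofs.WithK using (uip)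
open import Data.Bool using (true)
open import Data.Bool.Properties using (∧-commutativeMonoid)
open import Data.Product using (Σ; _×_; _,_; proj₁; proj₂)
open import Data.Product.Properties using (Σ-≡,≡→≡)
open import Data.Unit using (⊤; tt)
open import Relation.Binary.Bundles using (Setoid)
open import Relation.Binary.PropositionalEquality using (_≡_; refl; sym; trans; cong₂; subst)
open import Algebra.Properties.CommutativeSemigroup
  (CommutativeMonoid.commutativeSemigroup ∧-commutativeMonoid) using (interchange)

-- In PSet a morphism f : (X , φ) → (Y , ψ) is p-cartesian exactly when it reflects the
-- predicates, ψ (f x) ⇒ φ x.  The cartesian lift of u into (Y , ψ) is (X , ψ ∘ u) → (Y , ψ);
-- conversely, cartesianness of f factors the lift (X , ψ ∘ f) → (Y , ψ) through f over the
-- identity of X, which says exactly that f reflects.  Likewise a square of PSet↓ is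
-- p↓-cartesian exactly when both of its sides reflect.  Reflection is stable under products,
-- so Lift and ⊗ preserve cartesian morphisms.  Everything else (sections, the two squares and
-- the monoidal coherences) holds on the nose, since p and p↓ merely forget the predicates and
-- the structure on the PSet side is the Set structure decorated with ∧.

module HomReasoning (C : Cat) where
  open Cat C

  hom-setoid : Obj → Obj → Setoid _ _
  hom-setoid A B = record
    { Carrier = Hom A B
    ; _≈_ = _≈_
    ; isEquivalence = record { refl = ≈-refl ; sym = ≈-sym ; trans = ≈-trans }
    }

  module _ {A B : Obj} where
    open import Relation.Binary.Reasoning.Setoid (hom-setoid A B) public

module CartesianProperties {C : Cat} (CC : Cartesian C) where
  open Cat C
  open Cartesian CC

  ⟨⟩-cong : ∀ {X A B} {f f' : Hom X A} {g g' : Hom X B} →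
            f ≈ f' → g ≈ g' → ⟨ f , g ⟩ ≈ ⟨ f' , g' ⟩
  ⟨⟩-cong f≈f' g≈g' = ⟨⟩-unique (≈-trans β₁ f≈f') (≈-trans β₂ g≈g')

  ⟨⟩-∘ : ∀ {W X A B} {f : Hom X A} {g : Hom X B} {h : Hom W X} →
         ⟨ f , g ⟩ ∘ h ≈ ⟨ f ∘ h , g ∘ h ⟩
  ⟨⟩-∘ = ⟨⟩-unique (≈-trans (≈-sym assoc) (∘-resp-≈ β₁ ≈-refl))
                   (≈-trans (≈-sym assoc) (∘-resp-≈ β₂ ≈-refl))

  ⊗₁-∘-⟨⟩ : ∀ {X A A' B B'} {f : Hom A A'} {g : Hom B B'}
              {h : Hom X A} {k : Hom X B} →
            (f ⊗₁ g) ∘ ⟨ h , k ⟩ ≈ ⟨ f ∘ h , g ∘ k ⟩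
  ⊗₁-∘-⟨⟩ = ≈-trans ⟨⟩-∘ (⟨⟩-cong (pull β₁) (pull β₂))
    where
      pull : ∀ {X Y Z W} {f : Hom Y Z} {g : Hom W Y} {h : Hom X W} {gh : Hom X Y} →
             g ∘ h ≈ gh → (f ∘ g) ∘ h ≈ f ∘ gh
      pull g∘h≈gh = ≈-trans assoc (∘-resp-≈ ≈-refl g∘h≈gh)

  id⊗₁id : ∀ {A B} → id {A} ⊗₁ id {B} ≈ id
  id⊗₁id = ≈-sym (⟨⟩-unique (≈-trans identityʳ (≈-sym identityˡ))
                            (≈-trans identityʳ (≈-sym identityˡ)))

module _ {C : Cat} (CC : Cartesian C) where
  open Cat C
  open Cartesian CC
  open CartesianProperties CC
  open HomReasoning C
  open Arrow C using (ArrObj; arrObj; Sq; sq)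

  private
    _⊗ₐ_ : ArrObj → ArrObj → ArrObj
    A ⊗ₐ B = arrObj (ArrObj.src A ⊗₀ ArrObj.src B) (ArrObj.tgt A ⊗₀ ArrObj.tgt B)
                    (ArrObj.arr A ⊗₁ ArrObj.arr B)

    pair : ∀ {X A B} → Sq X A → Sq X B → Sq X (A ⊗ₐ B)
    pair {X} {A} {B} f g = sq ⟨ Sq.top f , Sq.top g ⟩ ⟨ Sq.bot f , Sq.bot g ⟩ (begin
      (ArrObj.arr A ⊗₁ ArrObj.arr B) ∘ ⟨ Sq.top f , Sq.top g ⟩
        ≈⟨ ⊗₁-∘-⟨⟩ ⟩
      ⟨ ArrObj.arr A ∘ Sq.top f , ArrObj.arr B ∘ Sq.top g ⟩
        ≈⟨ ⟨⟩-cong (Sq.comm f) (Sq.comm g) ⟩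
      ⟨ Sq.bot f ∘ ArrObj.arr X , Sq.bot g ∘ ArrObj.arr X ⟩
        ≈⟨ ⟨⟩-∘ ⟨
      ⟨ Sq.bot f , Sq.bot g ⟩ ∘ ArrObj.arr X ∎)

  arrow-cartesian : Cartesian (C ↓)
  arrow-cartesian = record
    { 𝟙 = arrObj 𝟙 𝟙 id
    ; ! = sq ! ! (≈-trans (!-unique _) (≈-sym (!-unique _)))
    ; !-unique = λ f → !-unique (Sq.top f) , !-unique (Sq.bot f)
    ; _⊗₀_ = _⊗ₐ_
    ; π₁ = sq π₁ π₁ (≈-sym β₁)
    ; π₂ = sq π₂ π₂ (≈-sym β₂)
    ; ⟨_,_⟩ = pair
    ; β₁ = β₁ , β₁
    ; β₂ = β₂ , β₂
    ; ⟨⟩-unique = λ (p , p') (q , q') → ⟨⟩-unique p q , ⟨⟩-unique p' q'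
    }

  cod-laxSymMonoidal : LaxSymMonoidal arrow-cartesian CC (cod C)
  cod-laxSymMonoidal = record
    { str = record { ε = id ; μ = λ _ _ → id }
    ; laws = record
      { μ-natural = λ _ _ → ≈-trans identityʳ (≈-sym identityˡ)
      ; μ-assoc = λ _ _ _ →
          ≈-trans (id⊗₁id-elimʳ (α⇒ _ _ _)) (≈-sym (id⊗₁id-elimˡ (α⇒ _ _ _)))
      ; μ-unitˡ = λ _ → id⊗₁id-elimʳ π₂
      ; μ-unitʳ = λ _ → id⊗₁id-elimʳ π₁
      ; μ-symm = λ _ _ → ≈-trans identityʳ (≈-sym identityˡ)
      }
    }
    where
      id⊗₁id-elimʳ : ∀ {A B X} (f : Hom (A ⊗₀ B) X) → f ∘ (id ∘ (id ⊗₁ id)) ≈ f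
      id⊗₁id-elimʳ f =
        ≈-trans (∘-resp-≈ ≈-refl (≈-trans identityˡ id⊗₁id)) identityʳ

      id⊗₁id-elimˡ : ∀ {X A B} (f : Hom X (A ⊗₀ B)) → id ∘ ((id ⊗₁ id) ∘ f) ≈ f
      id⊗₁id-elimˡ f =
        ≈-trans identityˡ (≈-trans (∘-resp-≈ id⊗₁id ≈-refl) identityˡ)

private
  module S = Cat SetC
  module PS = Cat PSet
  module AS = Arrow SetC
  module AP = Arrow PSet

SetC-cartesian : Cartesian SetC
SetC-cartesian = record
  { 𝟙 = ⊤
  ; ! = λ _ → tt
  ; !-unique = λ _ _ → refl
  ; _⊗₀_ = _×_
  ; π₁ = proj₁
  ; π₂ = proj₂
  ; ⟨_,_⟩ = λ f g x → f x , g x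
  ; β₁ = λ _ → refl
  ; β₂ = λ _ → refl
  ; ⟨⟩-unique = λ p q x → cong₂ _,_ (p x) (q x)
  }

PSet-cartesian : Cartesian PSet
PSet-cartesian = record
  { 𝟙 = ⊤ , (λ _ → true)
  ; ! = (λ _ → tt) , (λ _ _ → refl)
  ; !-unique = λ _ _ → refl
  ; _⊗₀_ = λ (X , φ) (Y , ψ) → (X × Y) , (φ ⊠ ψ)
  ; π₁ = λ {(_ , φ)} {(_ , ψ)} → proj₁ , λ (x , y) q → ∧-true₁ (φ x) (ψ y) q
  ; π₂ = λ {(_ , φ)} {(_ , ψ)} → proj₂ , λ (x , y) q → ∧-true₂ (φ x) (ψ y) q
  ; ⟨_,_⟩ = λ (f , hf) (g , hg) → (λ x → f x , g x) , (λ x q → ∧-intro (hf x q) (hg x q))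
  ; β₁ = λ _ → refl
  ; β₂ = λ _ → refl
  ; ⟨⟩-unique = λ p q x → cong₂ _,_ (p x) (q x)
  }

SetC↓-cartesian : Cartesian (SetC ↓)
SetC↓-cartesian = arrow-cartesian SetC-cartesian

PSet↓-cartesian : Cartesian (PSet ↓)
PSet↓-cartesian = arrow-cartesian PSet-cartesian

private
  module CP = Cartesian PSet-cartesian
  module CP↓ = Cartesian PSet↓-cartesian

Reflects : ∀ {X Y : PS.Obj} → PS.Hom X Y → Set
Reflects {_ , φ} {_ , ψ} (f , _) = ∀ x → ψ (f x) ≡ true → φ x ≡ true

⊗-reflects : ∀ {A A' B B' : PS.Obj} (f : PS.Hom A A') (g : PS.Hom B B') →
             Reflects {A} {A'} f → Reflects {B} {B'} g →
             Reflects {A CP.⊗₀ B} {A' CP.⊗₀ B'} (CP._⊗₁_ {A} {A'} {B} {B'} f g)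
⊗-reflects {_ , α} {_ , α'} {_ , β} {_ , β'} (f , _) (g , _) rf rg (x , y) q =
  ∧-intro (rf x (∧-true₁ (α' (f x)) (β' (g y)) q))
          (rg y (∧-true₂ (α' (f x)) (β' (g y)) q))

restrict : ∀ {X : Set} (Y : PS.Obj) → (X → proj₁ Y) → PS.Obj
restrict {X} (_ , ψ) u = X , λ x → ψ (u x)

restriction : ∀ {X : Set} (Y : PS.Obj) (u : X → proj₁ Y) → PS.Hom (restrict Y u) Y
restriction _ u = u , λ _ q → q

reflects⇒p-cartesian : ∀ {X Y : PS.Obj} (f : PS.Hom X Y) →
                       Reflects {X} {Y} f → IsCartesian p {X} {Y} f
reflects⇒p-cartesian {_ , φ} {_ , ψ} (f , _) rf (g , hg) h fh≈g =
  (h , λ x q → rf (h x) (subst (λ y → ψ y ≡ true) (sym (fh≈g x)) (hg x q)))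
  , (fh≈g , λ _ → refl) , λ _ _ k'≈h → k'≈h

restriction-inverse⇒reflects : ∀ {X Y : PS.Obj} (f : PS.Hom X Y)
                               (k : PS.Hom (restrict Y (proj₁ f)) X) →
                               (∀ x → proj₁ k x ≡ x) → Reflects {X} {Y} f
restriction-inverse⇒reflects {_ , φ} _ (k , hk) k≈id x q =
  subst (λ x → φ x ≡ true) (k≈id x) (hk x q)

p-cartesian⇒reflects : ∀ {X Y : PS.Obj} (f : PS.Hom X Y) →
                       IsCartesian p {X} {Y} f → Reflects {X} {Y} f
p-cartesian⇒reflects {X} {Y} f cart =
  restriction-inverse⇒reflects {X} {Y} f (proj₁ lift) (proj₂ (proj₁ (proj₂ lift)))
  where lift = cart (restriction Y (proj₁ f)) (λ x → x) (λ _ → refl)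

p-cleavage : Cleavage p
p-cleavage e u = record
  { dom = restrict e u
  ; dom-eq = refl
  ; arr = restriction e u
  ; arr-over = λ _ → refl
  ; arr-cart = reflects⇒p-cartesian {restrict e u} {e} (restriction e u) (λ _ q → q)
  }

p↓ : Functor (PSet ↓) (SetC ↓)
p↓ = p ↓F

Reflects↓ : ∀ {X Y : AP.ArrObj} → AP.Sq X Y → Set
Reflects↓ {AP.arrObj S T _} {AP.arrObj S' T' _} (AP.sq t b _) =
  Reflects {S} {S'} t × Reflects {T} {T'} b

⊗-reflects↓ : ∀ {A A' B B' : AP.ArrObj} (f : AP.Sq A A') (g : AP.Sq B B') →
              Reflects↓ f → Reflects↓ g →
              Reflects↓ {A CP↓.⊗₀ B} {A' CP↓.⊗₀ B'} (CP↓._⊗₁_ {A} {A'} {B} {B'} f g)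
⊗-reflects↓ {AP.arrObj S T _} {AP.arrObj S' T' _} {AP.arrObj U V _} {AP.arrObj U' V' _}
            (AP.sq ft fb _) (AP.sq gt gb _) (rft , rfb) (rgt , rgb) =
  ⊗-reflects {S} {S'} {U} {U'} ft gt rft rgt , ⊗-reflects {T} {T'} {V} {V'} fb gb rfb rgb

Lift-reflects : ∀ {X Y : PS.Obj} (f : PS.Hom X Y) → Reflects {X} {Y} f →
                Reflects↓ {Functor.F₀ Lift X} {Functor.F₀ Lift Y} (Functor.F₁ Lift f)
Lift-reflects {X} {Y} f rf = ⊗-reflects {X} {Y} {X} {Y} f f rf rf , rf

restrict↓ : ∀ {B : AS.ArrObj} (E : AP.ArrObj) → AS.Sq B (Functor.F₀ p↓ E) → AP.ArrObj
restrict↓ {AS.arrObj _ _ b} (AP.arrObj S T (e , he)) (AS.sq t u comm) =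
  AP.arrObj (restrict S t) (restrict T u)
            (b , λ x q → subst (λ y → proj₂ T y ≡ true) (comm x) (he (t x) q))

restriction↓ : ∀ {B : AS.ArrObj} (E : AP.ArrObj) (s : AS.Sq B (Functor.F₀ p↓ E)) →
               AP.Sq (restrict↓ E s) E
restriction↓ (AP.arrObj S T _) (AS.sq t u comm) =
  AP.sq (restriction S t) (restriction T u) comm

reflects↓⇒p↓-cartesian : ∀ {X Y : AP.ArrObj} (s : AP.Sq X Y) →
                         Reflects↓ s → IsCartesian p↓ s
reflects↓⇒p↓-cartesian {AP.arrObj S T _} {AP.arrObj S' T' _} (AP.sq t b _) (rt , rb)
  {AP.arrObj S'' T'' _} (AP.sq gt gb _) h (th≈gt , bh≈gb) =
  AP.sq (proj₁ (reflects⇒p-cartesian {S} {S'} t rt {S''} gt (AS.Sq.top h) th≈gt))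
        (proj₁ (reflects⇒p-cartesian {T} {T'} b rb {T''} gb (AS.Sq.bot h) bh≈gb))
        (AS.Sq.comm h)
  , ((th≈gt , bh≈gb) , (λ _ → refl) , (λ _ → refl)) , λ _ _ k'≈h → k'≈h

p↓-cartesian⇒reflects↓ : ∀ {X Y : AP.ArrObj} (s : AP.Sq X Y) →
                         IsCartesian p↓ s → Reflects↓ s
p↓-cartesian⇒reflects↓ {AP.arrObj S T _} {Y@(AP.arrObj S' T' _)} s@(AP.sq t b _) cart =
  restriction-inverse⇒reflects {S} {S'} t (AP.Sq.top k) kt≈id ,
  restriction-inverse⇒reflects {T} {T'} b (AP.Sq.bot k) kb≈id
  where
    lift = cart (restriction↓ Y (Functor.F₁ p↓ s)) (Cat.id (SetC ↓))
                ((λ _ → refl) , (λ _ → refl))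
    k = proj₁ lift
    kt≈id = proj₁ (proj₂ (proj₁ (proj₂ lift)))
    kb≈id = proj₂ (proj₂ (proj₁ (proj₂ lift)))

p↓-cleavage : Cleavage p↓
p↓-cleavage e u = record
  { dom = restrict↓ e u
  ; dom-eq = refl
  ; arr = restriction↓ e u
  ; arr-over = (λ _ → refl) , (λ _ → refl)
  ; arr-cart = reflects↓⇒p↓-cartesian (restriction↓ e u) ((λ _ q → q) , (λ _ q → q))
  }

equalizer-≡ : ∀ {X Y : Set} {l r : X → Y} {s t : Σ X (λ x → l x ≡ r x)} →
              proj₁ s ≡ proj₁ t → s ≡ t
equalizer-≡ s≡t = Σ-≡,≡→≡ (s≡t , uip _ _)

pullbackSet-isCleavage : IsCleavage (cod SetC) pullbackSet
pullbackSet-isCleavage e u = (λ _ → refl) , cartesian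
  where
    cartesian : IsCartesian (cod SetC) (RawLift.arr (pullbackSet e u))
    cartesian {AS.arrObj _ _ a} (AS.sq gt _ gc) h uh≈gb =
      AS.sq (λ x → (gt x , h (a x)) , trans (gc x) (sym (uh≈gb (a x)))) h (λ _ → refl)
      , (((λ _ → refl) , uh≈gb) , (λ _ → refl))
      , λ { (AS.sq _ _ kc) (kt≈gt , _) kb≈h →
              (λ x → equalizer-≡ (cong₂ _,_ (kt≈gt x) (trans (kc x) (kb≈h (a x)))))
              , kb≈h }

pullbackPSet-isCleavage : IsCleavage (cod PSet) pullbackPSet
pullbackPSet-isCleavage e u = (λ _ → refl) , cartesian
  where
    cartesian : IsCartesian (cod PSet) (RawLift.arr (pullbackPSet e u))
    cartesian {AP.arrObj _ _ (a , ha)} (AP.sq (gt , hgt) _ gc) (h , hh) uh≈gb =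
      AP.sq ((λ x → (gt x , h (a x)) , trans (gc x) (sym (uh≈gb (a x))))
             , λ x q → ∧-intro (hgt x q) (hh (a x) (ha x q)))
            (h , hh) (λ _ → refl)
      , (((λ _ → refl) , uh≈gb) , (λ _ → refl))
      , λ { (AP.sq _ _ kc) (kt≈gt , _) kb≈h →
              (λ x → equalizer-≡ (cong₂ _,_ (kt≈gt x) (trans (kc x) (kb≈h (a x)))))
              , kb≈h }

SetTangency-isTangency : IsTangency SetTangency
SetTangency-isTangency = record
  { cloven = pullbackSet-isCleavage
  ; section = record { eq₀ = λ _ → refl ; eq₁ = λ _ _ → refl }
  }

PSetTangency-isTangency : IsTangency PSetTangency
PSetTangency-isTangency = record
  { cloven = pullbackPSet-isCleavage
  ; section = record { eq₀ = λ _ → refl ; eq₁ = λ _ _ → refl }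
  }

p-isFibrationOfTangencies : IsFibrationOfTangencies PSetTangency SetTangency p p↓
p-isFibrationOfTangencies = record
  { source-tangency = PSetTangency-isTangency
  ; target-tangency = SetTangency-isTangency
  ; square-π = record { eq₀ = λ _ → refl ; eq₁ = λ _ _ → refl }
  ; square-T = record { eq₀ = λ _ → refl ; eq₁ = λ _ → (λ _ → refl) , (λ _ → refl) }
  ; pB-fibration = p-cleavage
  ; pE-fibration = p↓-cleavage
  ; chosen-to-chosen = λ _ _ → refl , (λ _ → refl) , (λ _ → refl)
  ; Lift-cartesian = λ {X} {Y} f cart →
      reflects↓⇒p↓-cartesian (Functor.F₁ Lift f)
        (Lift-reflects {X} {Y} f (p-cartesian⇒reflects {X} {Y} f cart))
  }

p-laxSymMonoidal : LaxSymMonoidal PSet-cartesian SetC-cartesian p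
p-laxSymMonoidal = record
  { str = record { ε = S.id ; μ = λ _ _ → S.id }
  ; laws = record
    { μ-natural = λ _ _ _ → refl
    ; μ-assoc = λ _ _ _ _ → refl
    ; μ-unitˡ = λ _ _ → refl
    ; μ-unitʳ = λ _ _ → refl
    ; μ-symm = λ _ _ _ → refl
    }
  }

p↓-laxSymMonoidal : LaxSymMonoidal PSet↓-cartesian SetC↓-cartesian p↓
p↓-laxSymMonoidal = record
  { str = record { ε = Cat.id (SetC ↓) ; μ = λ _ _ → Cat.id (SetC ↓) }
  ; laws = record
    { μ-natural = λ _ _ → (λ _ → refl) , (λ _ → refl)
    ; μ-assoc = λ _ _ _ → (λ _ → refl) , (λ _ → refl)
    ; μ-unitˡ = λ _ → (λ _ → refl) , (λ _ → refl)
    ; μ-unitʳ = λ _ → (λ _ → refl) , (λ _ → refl)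
    ; μ-symm = λ _ _ → (λ _ → refl) , (λ _ → refl)
    }
  }

swap-middle : ∀ {A A' B B' : Set} → (A × A') × (B × B') → (A × B) × (A' × B')
swap-middle ((a , a') , (b , b')) = (a , b) , (a' , b')

T-laxSymMonoidal : LaxSymMonoidal SetC-cartesian SetC↓-cartesian T
T-laxSymMonoidal = record
  { str = record
    { ε = AS.sq (λ _ → tt , tt) S.id (λ _ → refl)
    ; μ = λ _ _ → AS.sq swap-middle S.id (λ _ → refl)
    }
  ; laws = record
    { μ-natural = λ _ _ → (λ _ → refl) , (λ _ → refl)
    ; μ-assoc = λ _ _ _ → (λ _ → refl) , (λ _ → refl)
    ; μ-unitˡ = λ _ → (λ _ → refl) , (λ _ → refl)
    ; μ-unitʳ = λ _ → (λ _ → refl) , (λ _ → refl)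
    ; μ-symm = λ _ _ → (λ _ → refl) , (λ _ → refl)
    }
  }

Lift-laxSymMonoidal : LaxSymMonoidal PSet-cartesian PSet↓-cartesian Lift
Lift-laxSymMonoidal = record
  { str = record
    { ε = AP.sq ((λ _ → tt , tt) , λ _ _ → refl) PS.id (λ _ → refl)
    ; μ = λ (_ , α) (_ , β) → AP.sq
        (swap-middle , λ ((a , a') , (b , b')) q →
                         trans (sym (interchange (α a) (α a') (β b) (β b'))) q)
        PS.id (λ _ → refl)
    }
  ; laws = record
    { μ-natural = λ _ _ → (λ _ → refl) , (λ _ → refl)
    ; μ-assoc = λ _ _ _ → (λ _ → refl) , (λ _ → refl)
    ; μ-unitˡ = λ _ → (λ _ → refl) , (λ _ → refl)
    ; μ-unitʳ = λ _ → (λ _ → refl) , (λ _ → refl)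
    ; μ-symm = λ _ _ → (λ _ → refl) , (λ _ → refl)
    }
  }

p-isStrictMonoidalFibration :
  IsStrictMonoidalFibration PSet-cartesian SetC-cartesian p p-laxSymMonoidal
p-isStrictMonoidalFibration = record
  { unit-eq = refl
  ; tensor-eq = λ _ _ → refl
  ; ε-strict = λ _ → refl
  ; μ-strict = λ _ _ _ → refl
  ; ⊗-cartesian = λ {A} {A'} {B} {B'} f g cf cg →
      reflects⇒p-cartesian {A CP.⊗₀ B} {A' CP.⊗₀ B'} (CP._⊗₁_ {A} {A'} {B} {B'} f g)
        (⊗-reflects {A} {A'} {B} {B'} f g (p-cartesian⇒reflects {A} {A'} f cf)
                                          (p-cartesian⇒reflects {B} {B'} g cg))
  }

p↓-isStrictMonoidalFibration :
  IsStrictMonoidalFibration PSet↓-cartesian SetC↓-cartesian p↓ p↓-laxSymMonoidal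
p↓-isStrictMonoidalFibration = record
  { unit-eq = refl
  ; tensor-eq = λ _ _ → refl
  ; ε-strict = (λ _ → refl) , (λ _ → refl)
  ; μ-strict = λ _ _ → (λ _ → refl) , (λ _ → refl)
  ; ⊗-cartesian = λ {A} {A'} {B} {B'} f g cf cg →
      reflects↓⇒p↓-cartesian (CP↓._⊗₁_ {A} {A'} {B} {B'} f g)
        (⊗-reflects↓ f g (p↓-cartesian⇒reflects↓ f cf) (p↓-cartesian⇒reflects↓ g cg))
  }

lemma6 : IsCartesianMonoidalFibrationOfTangencies PSetTangency SetTangency p (p ↓F)
lemma6 = record
  { fibration = p-isFibrationOfTangencies
  ; cart-PE = PSet↓-cartesian
  ; cart-PB = PSet-cartesian
  ; cart-E = SetC↓-cartesian
  ; cart-B = SetC-cartesian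
  ; mon-Pπ = cod-laxSymMonoidal PSet-cartesian
  ; mon-Lift = Lift-laxSymMonoidal
  ; mon-π = cod-laxSymMonoidal SetC-cartesian
  ; mon-T = T-laxSymMonoidal
  ; mon-pB = p-laxSymMonoidal
  ; mon-pE = p↓-laxSymMonoidal
  ; pB-strict = p-isStrictMonoidalFibration
  ; pE-strict = p↓-isStrictMonoidalFibration
  ; square-π-monoidal = (λ _ → refl) , (λ _ _ _ → refl)
  ; square-T-monoidal = ((λ _ → refl) , (λ _ → refl)) , (λ _ _ → (λ _ → refl) , (λ _ → refl))
  }
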